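{- Let $\mathcal{G}_n$ be the set of words over $\{0,1\}$ with $n$ zeros and $n$ ones. For nonnegative integers $n,k$, the number of words in $\mathcal{G}_n$ with exactly $k$ occurrences of $001$ equals $$\binom{n}{2k}\binom{2k}{k}2^{n-2k}.$$ Moreover, for nonnegative integers $n,k,\ell$ with $k\le\ell$ and $k+\ell\le n$, the number of words in $\mathcal{G}_n$ with exactly $k$ occurrences of $001$ and exactly $\ell$ occurrences of $01$ equals $$\binom{n}{2k}\binom{2k}{k}\binom{n-2k}{\ell-k}=\frac{n!}{k!^2(\ell-k)!(n-k-\ell)!}.$$
   Context: Occurrences of $001$ (resp. $01$) in a word $w$ mean occurrences as consecutive subwords, i.e., indices $j$ with $w_jw_{j+1}w_{j+2}=001$ (resp. $w_jw_{j+1}=01$). -}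

module Defs where

open import Data.Bool using (Bool; true; false; _∧_; not)
open import Data.Nat using (ℕ; zero; suc; _+_; _≡ᵇ_)
open import Data.List using (List; []; _∷_; map; _++_; filterᵇ; length)

-- Binary words: a word over {0,1} is a list of Booleans, with false = 0, true = 1.
Word : Set
Word = List Bool

allWords : ℕ → List Word
allWords zero = [] ∷ []
allWords (suc m) = map (false ∷_) (allWords m) ++ map (true ∷_) (allWords m)

zeros : Word → ℕ
zeros [] = 0
zeros (false ∷ w) = suc (zeros w)
zeros (true ∷ w) = zeros w

ones : Word → ℕ
ones [] = 0
ones (true ∷ w) = suc (ones w)
ones (false ∷ w) = ones w

occ01 : Word → ℕ
occ01 (false ∷ true ∷ w) = suc (occ01 (true ∷ w))
occ01 (_ ∷ w) = occ01 w
occ01 [] = 0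

occ001 : Word → ℕ
occ001 (false ∷ false ∷ true ∷ w) = suc (occ001 (false ∷ true ∷ w))
occ001 (_ ∷ w) = occ001 w
occ001 [] = 0

inGᵇ : ℕ → Word → Bool
inGᵇ n w = (zeros w ≡ᵇ n) ∧ (ones w ≡ᵇ n)

G : ℕ → List Word
G n = filterᵇ (inGᵇ n) (allWords (n + n))

countG : ℕ → (Word → Bool) → ℕ
countG n p = length (filterᵇ p (G n))

{-# OPTIONS --safe #-}
module Submission where

-- Read a word from left to right, remembering the length (0, 1 or at least 2) of the
-- run of 0s just read: a 1 read after a nonempty run closes an occurrence of 01, and
-- of 001 if the run is long. Counting the words with z zeros, o ones, k occurrences of
-- 001 and ℓ of 01 from each of the three states by the first-letter recurrence, one
-- checks with Pascal's rule that the count is (o C ℓ) * (ℓ C k) * ((z ∸ ℓ) C k) from the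
-- initial state. For z = o = n this is the multinomial n! / (k! k! (ℓ-k)! (n-k-ℓ)!),
-- and summing over ℓ leaves (n C 2k) * (2k C k) * ∑ⱼ ((n ∸ 2k) C j).

open import Defs
open import Data.Bool using (Bool; true; false; _∧_; T)
open import Data.Bool.Properties using (∧-assoc; ∧-zeroʳ; T-∧; T?)
open import Data.Nat using (ℕ; zero; suc; _!; _+_; _*_; _∸_; _^_; _≤_; _<_; _≡ᵇ_; z≤n; s≤s)
open import Data.Nat.Properties
open import Data.Nat.Combinatorics using (_C_; nCk+nC[k+1]≡[n+1]C[k+1]; k>n⇒nCk≡0; nCk≡n!/k![n-k]!; k![n∸k]!∣n!)
open import Data.Nat.DivMod using (_/_; m/n*n≡m)
open import Data.Nat.Tactic.RingSolver using (solve-∀)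
open import Data.List using (List; []; _∷_; map; _++_; filterᵇ; length)
open import Data.List.Properties using (filter-++; length-++)
open import Data.List.Relation.Unary.All as All using (All; []; _∷_)
open import Data.List.Relation.Unary.All.Properties using (all-filter)
open import Data.Product using (_×_; _,_; proj₂)
open import Data.Sum using (_⊎_; inj₁; inj₂)
open import Function using (_∘_)
open import Function.Bundles using (Equivalence)
open import Relation.Nullary using (yes; no)
open import Relation.Binary.PropositionalEquality

open ≡-Reasoning

𝟙 : Bool → ℕ
𝟙 true = 1
𝟙 false = 0

∑< : ℕ → (ℕ → ℕ) → ℕ
∑< zero f = 0
∑< (suc b) f = f 0 + ∑< b (f ∘ suc)

syntax ∑< b (λ i → e) = ∑[ i < b ] e

∑-cong : ∀ b {f g : ℕ → ℕ} → (∀ i → i < b → f i ≡ g i) → ∑< b f ≡ ∑< b g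
∑-cong zero f≗g = refl
∑-cong (suc b) f≗g = cong₂ _+_ (f≗g 0 (s≤s z≤n)) (∑-cong b (λ i i<b → f≗g (suc i) (s≤s i<b)))

∑-zero : ∀ b (f : ℕ → ℕ) → (∀ i → i < b → f i ≡ 0) → ∑< b f ≡ 0
∑-zero zero f f≗0 = refl
∑-zero (suc b) f f≗0 = cong₂ _+_ (f≗0 0 (s≤s z≤n)) (∑-zero b (f ∘ suc) (λ i i<b → f≗0 (suc i) (s≤s i<b)))

∑-distrib-+ : ∀ b (f g : ℕ → ℕ) → ∑[ i < b ] (f i + g i) ≡ ∑< b f + ∑< b g
∑-distrib-+ zero f g = refl
∑-distrib-+ (suc b) f g = begin
  (f 0 + g 0) + ∑[ i < b ] (f (suc i) + g (suc i))     ≡⟨ cong (f 0 + g 0 +_) (∑-distrib-+ b (f ∘ suc) (g ∘ suc)) ⟩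
  (f 0 + g 0) + (∑< b (f ∘ suc) + ∑< b (g ∘ suc))     ≡⟨ +-+-comm (f 0) (g 0) _ _ ⟩
  (f 0 + ∑< b (f ∘ suc)) + (g 0 + ∑< b (g ∘ suc))     ∎
  where
  +-+-comm : ∀ a b c d → (a + b) + (c + d) ≡ (a + c) + (b + d)
  +-+-comm = solve-∀

*-distribˡ-∑ : ∀ b c (f : ℕ → ℕ) → ∑[ i < b ] (c * f i) ≡ c * ∑< b f
*-distribˡ-∑ zero c f = sym (*-zeroʳ c)
*-distribˡ-∑ (suc b) c f = trans (cong (c * f 0 +_) (*-distribˡ-∑ b c (f ∘ suc))) (sym (*-distribˡ-+ c (f 0) _))

∑-split : ∀ a b (f : ℕ → ℕ) → ∑< (a + b) f ≡ ∑< a f + ∑[ i < b ] f (a + i)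
∑-split zero b f = refl
∑-split (suc a) b f = trans (cong (f 0 +_) (∑-split a b (f ∘ suc))) (sym (+-assoc (f 0) _ _))

∑-𝟙-≡ᵇ : ∀ {a} b → a < b → ∑[ i < b ] 𝟙 (a ≡ᵇ i) ≡ 1
∑-𝟙-≡ᵇ {zero} (suc b) _ = cong suc (∑-zero b _ (λ _ _ → refl))
∑-𝟙-≡ᵇ {suc a} (suc b) (s≤s a<b) = ∑-𝟙-≡ᵇ b a<b

∑-C : ∀ m b → m < b → ∑[ j < b ] (m C j) ≡ 2 ^ m
∑-C zero (suc b) _ = cong suc (∑-zero b _ (λ _ _ → refl))
∑-C (suc m) (suc b) (s≤s m<b) = begin
  1 + ∑[ j < b ] (suc m C suc j)                   ≡⟨ cong (1 +_) (∑-cong b (λ j _ → sym (nCk+nC[k+1]≡[n+1]C[k+1] m j))) ⟩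
  1 + ∑[ j < b ] (m C j + m C suc j)               ≡⟨ cong (1 +_) (∑-distrib-+ b (m C_) (λ j → m C suc j)) ⟩
  1 + (∑< b (m C_) + ∑[ j < b ] (m C suc j))       ≡⟨ sym (+-suc (∑< b (m C_)) _) ⟩
  ∑< b (m C_) + ∑< (suc b) (m C_)                  ≡⟨ cong₂ _+_ (∑-C m b m<b) (∑-C m (suc b) (m<n⇒m<1+n m<b)) ⟩
  2 ^ m + 2 ^ m                                    ≡⟨ cong (2 ^ m +_) (sym (+-identityʳ (2 ^ m))) ⟩
  2 ^ suc m                                        ∎

module _ {A : Set} where

  count : (A → Bool) → List A → ℕ
  count p xs = length (filterᵇ p xs)

  count-∷ : ∀ p x xs → count p (x ∷ xs) ≡ 𝟙 (p x) + count p xs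
  count-∷ p x xs with p x
  ... | true = refl
  ... | false = refl

  count-++ : ∀ p xs ys → count p (xs ++ ys) ≡ count p xs + count p ys
  count-++ p xs ys = trans (cong length (filter-++ (T? ∘ p) xs ys)) (length-++ (filterᵇ p xs))

  count-map : ∀ p (f : A → A) xs → count p (map f xs) ≡ count (p ∘ f) xs
  count-map p f [] = refl
  count-map p f (x ∷ xs) with p (f x)
  ... | true = cong suc (count-map p f xs)
  ... | false = count-map p f xs

  count-cong : ∀ {p q : A → Bool} → (∀ x → p x ≡ q x) → ∀ xs → count p xs ≡ count q xs
  count-cong p≗q [] = refl
  count-cong {p} {q} p≗q (x ∷ xs) = begin
    count p (x ∷ xs)       ≡⟨ count-∷ p x xs ⟩
    𝟙 (p x) + count p xs   ≡⟨ cong₂ _+_ (cong 𝟙 (p≗q x)) (count-cong p≗q xs) ⟩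
    𝟙 (q x) + count q xs   ≡⟨ count-∷ q x xs ⟨
    count q (x ∷ xs)       ∎

  count-none : ∀ p → (∀ x → p x ≡ false) → ∀ xs → count p xs ≡ 0
  count-none p p≗false [] = refl
  count-none p p≗false (x ∷ xs) =
    trans (count-∷ p x xs) (cong₂ _+_ (cong 𝟙 (p≗false x)) (count-none p p≗false xs))

  count-filterᵇ : ∀ q p xs → count p (filterᵇ q xs) ≡ count (λ x → q x ∧ p x) xs
  count-filterᵇ q p [] = refl
  count-filterᵇ q p (x ∷ xs) with q x
  ... | false = count-filterᵇ q p xs
  ... | true with p x
  ...   | true = cong suc (count-filterᵇ q p xs)
  ...   | false = count-filterᵇ q p xs

  count-partition : ∀ p (g : A → ℕ) {b} xs → All (λ x → g x < b) xs →
                    count p xs ≡ ∑[ ℓ < b ] count (λ x → p x ∧ (g x ≡ᵇ ℓ)) xs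
  count-partition p g {b} [] [] = sym (∑-zero b _ (λ _ _ → refl))
  count-partition p g {b} (x ∷ xs) (gx<b ∷ bounded) = begin
    count p (x ∷ xs)                                                   ≡⟨ count-∷ p x xs ⟩
    𝟙 (p x) + count p xs                                               ≡⟨ cong₂ _+_ (sym (∑-𝟙-value (p x))) (count-partition p g xs bounded) ⟩
    ∑[ ℓ < b ] 𝟙 (p x ∧ (g x ≡ᵇ ℓ)) + ∑[ ℓ < b ] count (q ℓ) xs       ≡⟨ ∑-distrib-+ b _ _ ⟨
    ∑[ ℓ < b ] (𝟙 (p x ∧ (g x ≡ᵇ ℓ)) + count (q ℓ) xs)                 ≡⟨ ∑-cong b (λ ℓ _ → sym (count-∷ (q ℓ) x xs)) ⟩
    ∑[ ℓ < b ] count (q ℓ) (x ∷ xs)                                    ∎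
    where
    q : ℕ → A → Bool
    q ℓ y = p y ∧ (g y ≡ᵇ ℓ)
    ∑-𝟙-value : ∀ c → ∑[ ℓ < b ] 𝟙 (c ∧ (g x ≡ᵇ ℓ)) ≡ 𝟙 c
    ∑-𝟙-value false = ∑-zero b _ (λ _ _ → refl)
    ∑-𝟙-value true = ∑-𝟙-≡ᵇ b gx<b

count-allWords-suc : ∀ m p → count p (allWords (suc m)) ≡ count (p ∘ (false ∷_)) (allWords m) + count (p ∘ (true ∷_)) (allWords m)
count-allWords-suc m p = trans (count-++ p (map (false ∷_) (allWords m)) _)
  (cong₂ _+_ (count-map p (false ∷_) (allWords m)) (count-map p (true ∷_) (allWords m)))

-- (z ∸ ℓ) C k, except that it is 0 (rather than 0 C k) when z < ℓ.
C-after : ℕ → ℕ → ℕ → ℕ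
C-after z zero k = z C k
C-after zero (suc ℓ) k = 0
C-after (suc z) (suc ℓ) k = C-after z ℓ k

C-after-0 : ∀ ℓ k → C-after 0 ℓ (suc k) ≡ 0
C-after-0 zero k = refl
C-after-0 (suc ℓ) k = refl

C-after-pascal : ∀ z ℓ k → C-after (suc z) ℓ (suc k) ≡ C-after z ℓ k + C-after z ℓ (suc k)
C-after-pascal z zero k = sym (nCk+nC[k+1]≡[n+1]C[k+1] z k)
C-after-pascal zero (suc ℓ) k = C-after-0 ℓ k
C-after-pascal (suc z) (suc ℓ) k = C-after-pascal z ℓ k

C-after-vanishes : ∀ z ℓ k → z < ℓ + k → C-after z ℓ k ≡ 0
C-after-vanishes z zero k z<k = k>n⇒nCk≡0 z<k
C-after-vanishes zero (suc ℓ) k _ = refl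
C-after-vanishes (suc z) (suc ℓ) k (s≤s z<ℓ+k) = C-after-vanishes z ℓ k z<ℓ+k

C-after-+ : ∀ ℓ x k → C-after (ℓ + x) ℓ k ≡ x C k
C-after-+ zero x k = refl
C-after-+ (suc ℓ) x k = C-after-+ ℓ x k

-- The length of the run of 0s just read, capped at 2; withRun r w is w read after such a
-- run. A third 0 changes neither occ01 nor occ001, so occ01 and occ001 of withRun r (b ∷ w)
-- compute, by their definitions, to those of withRun r′ w for the next state r′, plus the
-- occurrences closed by b.
data Run : Set where
  none one many : Run

extend : Run → Run
extend none = one
extend one = many
extend many = many

withRun : Run → Word → Word
withRun none w = w
withRun one w = false ∷ w
withRun many w = false ∷ false ∷ w

hasProfile : Run → ℕ → ℕ → ℕ → ℕ → Word → Bool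
hasProfile r z o k ℓ w =
  (zeros w ≡ᵇ z) ∧ (ones w ≡ᵇ o) ∧ (occ001 (withRun r w) ≡ᵇ k) ∧ (occ01 (withRun r w) ≡ᵇ ℓ)

hasProfile-0∷ : ∀ r z o k ℓ w → hasProfile r (suc z) o k ℓ (false ∷ w) ≡ hasProfile (extend r) z o k ℓ w
hasProfile-0∷ none z o k ℓ w = refl
hasProfile-0∷ one z o k ℓ w = refl
hasProfile-0∷ many z o k ℓ w = refl

-- From the state none: choose the ℓ ones preceded by a 0 and the k of them preceded by
-- 00; the z - ℓ - k zeros not forced by this choice are spread over the k long runs and
-- the final run, in (z ∸ ℓ) C k ways.
profileCount : Run → ℕ → ℕ → ℕ → ℕ → ℕ
profileCount none z o k ℓ = (o C ℓ) * (ℓ C k) * C-after z ℓ k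
profileCount one z zero k ℓ = 𝟙 ((0 ≡ᵇ k) ∧ (0 ≡ᵇ ℓ))
profileCount one z (suc o) k zero = 0
profileCount one z (suc o) k (suc ℓ) = (o C ℓ) * (suc ℓ C k) * C-after z ℓ k
profileCount many z zero k ℓ = 𝟙 ((0 ≡ᵇ k) ∧ (0 ≡ᵇ ℓ))
profileCount many z (suc o) k zero = 0
profileCount many z (suc o) zero (suc ℓ) = 0
profileCount many z (suc o) (suc k) (suc ℓ) = (o C ℓ) * (ℓ C k) * C-after (suc z) ℓ (suc k)

-- The counts that profileCount predicts for the words beginning with 0, resp. with 1.
afterZero : Run → ℕ → ℕ → ℕ → ℕ → ℕ
afterZero r zero o k ℓ = 0
afterZero r (suc z) o k ℓ = profileCount (extend r) z o k ℓ

afterOne : Run → ℕ → ℕ → ℕ → ℕ → ℕ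
afterOne r z zero k ℓ = 0
afterOne none z (suc o) k ℓ = profileCount none z o k ℓ
afterOne one z (suc o) k zero = 0
afterOne one z (suc o) k (suc ℓ) = profileCount none z o k ℓ
afterOne many z (suc o) k zero = 0
afterOne many z (suc o) zero (suc ℓ) = 0
afterOne many z (suc o) (suc k) (suc ℓ) = profileCount none z o k ℓ

*-distribʳ-+₂ : ∀ a b x y → (a + b) * x * y ≡ a * x * y + b * x * y
*-distribʳ-+₂ = solve-∀

*-distrib-middle : ∀ a x y b → a * (x + y) * b ≡ a * x * b + a * y * b
*-distrib-middle = solve-∀

*-zeroʳ-both : ∀ x y → x * 0 ≡ y * 0
*-zeroʳ-both x y = trans (*-zeroʳ x) (sym (*-zeroʳ y))

profileCount-none-step : ∀ z o k ℓ → 0 < z + o → profileCount none z o k ℓ ≡ afterZero none z o k ℓ + afterOne none z o k ℓ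
profileCount-none-step (suc z) zero zero zero _ = refl
profileCount-none-step (suc z) zero (suc k) zero _ = refl
profileCount-none-step (suc z) zero zero (suc ℓ) _ = refl
profileCount-none-step (suc z) zero (suc k) (suc ℓ) _ = refl
profileCount-none-step zero (suc o) k zero _ = refl
profileCount-none-step zero (suc o) k (suc ℓ) _ = *-zeroʳ-both ((suc o C suc ℓ) * (suc ℓ C k)) ((o C suc ℓ) * (suc ℓ C k))
profileCount-none-step (suc z) (suc o) k zero _ = refl
profileCount-none-step (suc z) (suc o) k (suc ℓ) _ =
  trans (cong (λ c → c * (suc ℓ C k) * C-after z ℓ k) (sym (nCk+nC[k+1]≡[n+1]C[k+1] o ℓ)))
        (*-distribʳ-+₂ (o C ℓ) (o C suc ℓ) (suc ℓ C k) (C-after z ℓ k))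

profileCount-one-step : ∀ z o k ℓ → 0 < z + o → profileCount one z o k ℓ ≡ afterZero one z o k ℓ + afterOne one z o k ℓ
profileCount-one-step (suc z) zero k ℓ _ = sym (+-identityʳ _)
profileCount-one-step zero (suc o) k zero _ = refl
profileCount-one-step zero (suc o) zero (suc zero) _ = refl
profileCount-one-step zero (suc o) (suc k) (suc zero) _ = *-zeroʳ-both ((o C 0) * (1 C suc k)) ((o C 0) * (0 C suc k))
profileCount-one-step zero (suc o) k (suc (suc ℓ)) _ = *-zeroʳ-both ((o C suc ℓ) * (suc (suc ℓ) C k)) ((o C suc ℓ) * (suc ℓ C k))
profileCount-one-step (suc z) (suc o) k zero _ = refl
profileCount-one-step (suc z) (suc o) zero (suc ℓ) _ = refl
profileCount-one-step (suc z) (suc o) (suc k) (suc ℓ) _ =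
  trans (cong (λ c → (o C ℓ) * c * C-after (suc z) ℓ (suc k)) (sym (nCk+nC[k+1]≡[n+1]C[k+1] ℓ k)))
        (*-distrib-middle (o C ℓ) (ℓ C k) (ℓ C suc k) (C-after (suc z) ℓ (suc k)))

profileCount-many-step : ∀ z o k ℓ → 0 < z + o → profileCount many z o k ℓ ≡ afterZero many z o k ℓ + afterOne many z o k ℓ
profileCount-many-step (suc z) zero k ℓ _ = sym (+-identityʳ _)
profileCount-many-step zero (suc o) k zero _ = refl
profileCount-many-step zero (suc o) zero (suc ℓ) _ = refl
profileCount-many-step zero (suc o) (suc k) (suc ℓ) _ =
  cong ((o C ℓ) * (ℓ C k) *_) (trans (C-after-pascal 0 ℓ k) (trans (cong (C-after 0 ℓ k +_) (C-after-0 ℓ k)) (+-identityʳ _)))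
profileCount-many-step (suc z) (suc o) k zero _ = refl
profileCount-many-step (suc z) (suc o) zero (suc ℓ) _ = refl
profileCount-many-step (suc z) (suc o) (suc k) (suc ℓ) _ = begin
  x * C-after (suc (suc z)) ℓ (suc k)                  ≡⟨ cong (x *_) (C-after-pascal (suc z) ℓ k) ⟩
  x * (C-after (suc z) ℓ k + C-after (suc z) ℓ (suc k)) ≡⟨ *-distribˡ-+ x _ _ ⟩
  x * C-after (suc z) ℓ k + x * C-after (suc z) ℓ (suc k) ≡⟨ +-comm (x * C-after (suc z) ℓ k) _ ⟩
  x * C-after (suc z) ℓ (suc k) + x * C-after (suc z) ℓ k ∎
  where
  x = (o C ℓ) * (ℓ C k)

profileCount-step : ∀ r z o k ℓ → 0 < z + o → profileCount r z o k ℓ ≡ afterZero r z o k ℓ + afterOne r z o k ℓ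
profileCount-step none = profileCount-none-step
profileCount-step one = profileCount-one-step
profileCount-step many = profileCount-many-step

∧-zeroʳ₂ : ∀ a b → a ∧ b ∧ false ≡ false
∧-zeroʳ₂ a b = trans (cong (a ∧_) (∧-zeroʳ b)) (∧-zeroʳ a)

∧-zeroʳ₃ : ∀ a b c → a ∧ b ∧ c ∧ false ≡ false
∧-zeroʳ₃ a b c = trans (cong (a ∧_) (∧-zeroʳ₂ b c)) (∧-zeroʳ a)

count-hasProfile : ∀ m r z o k ℓ → z + o ≡ m → count (hasProfile r z o k ℓ) (allWords m) ≡ profileCount r z o k ℓ
count-hasProfile zero r zero zero k ℓ refl = trans (count-∷ (hasProfile r 0 0 k ℓ) [] []) (trans (+-identityʳ _) (profile-[] r k ℓ))
  where
  profile-[] : ∀ r k ℓ → 𝟙 (hasProfile r 0 0 k ℓ []) ≡ profileCount r 0 0 k ℓ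
  profile-[] none zero zero = refl
  profile-[] none zero (suc ℓ) = refl
  profile-[] none (suc k) zero = refl
  profile-[] none (suc k) (suc ℓ) = refl
  profile-[] one k ℓ = refl
  profile-[] many k ℓ = refl
count-hasProfile (suc m) r z o k ℓ z+o≡1+m = begin
  count (hasProfile r z o k ℓ) (allWords (suc m))
    ≡⟨ count-allWords-suc m (hasProfile r z o k ℓ) ⟩
  count (hasProfile r z o k ℓ ∘ (false ∷_)) (allWords m) + count (hasProfile r z o k ℓ ∘ (true ∷_)) (allWords m)
    ≡⟨ cong₂ _+_ (afterZero-count r z o k ℓ z+o≡1+m) (afterOne-count r z o k ℓ z+o≡1+m) ⟩
  afterZero r z o k ℓ + afterOne r z o k ℓ
    ≡⟨ profileCount-step r z o k ℓ (subst (0 <_) (sym z+o≡1+m) (s≤s z≤n)) ⟨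
  profileCount r z o k ℓ ∎
  where
  one-fewer : ∀ {z o} → z + suc o ≡ suc m → z + o ≡ m
  one-fewer {z} {o} e = suc-injective (trans (sym (+-suc z o)) e)
  afterZero-count : ∀ r z o k ℓ → z + o ≡ suc m → count (hasProfile r z o k ℓ ∘ (false ∷_)) (allWords m) ≡ afterZero r z o k ℓ
  afterZero-count r zero o k ℓ _ = count-none _ (λ _ → refl) (allWords m)
  afterZero-count r (suc z) o k ℓ e =
    trans (count-cong (hasProfile-0∷ r z o k ℓ) (allWords m)) (count-hasProfile m (extend r) z o k ℓ (suc-injective e))
  afterOne-count : ∀ r z o k ℓ → z + o ≡ suc m → count (hasProfile r z o k ℓ ∘ (true ∷_)) (allWords m) ≡ afterOne r z o k ℓ
  afterOne-count r z zero k ℓ _ = count-none _ (λ w → ∧-zeroʳ (zeros w ≡ᵇ z)) (allWords m)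
  afterOne-count none z (suc o) k ℓ e = count-hasProfile m none z o k ℓ (one-fewer e)
  afterOne-count one z (suc o) k zero _ = count-none _ (λ w → ∧-zeroʳ₃ (zeros w ≡ᵇ z) (ones w ≡ᵇ o) (occ001 w ≡ᵇ k)) (allWords m)
  afterOne-count one z (suc o) k (suc ℓ) e = count-hasProfile m none z o k ℓ (one-fewer e)
  afterOne-count many z (suc o) k zero _ = count-none _ (λ w → ∧-zeroʳ₃ (zeros w ≡ᵇ z) (ones w ≡ᵇ o) (suc (occ001 w) ≡ᵇ k)) (allWords m)
  afterOne-count many z (suc o) zero (suc ℓ) _ = count-none _ (λ w → ∧-zeroʳ₂ (zeros w ≡ᵇ z) (ones w ≡ᵇ o)) (allWords m)
  afterOne-count many z (suc o) (suc k) (suc ℓ) e = count-hasProfile m none z o k ℓ (one-fewer e)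

C-split : ∀ a b → ((a + b) C a) * (a ! * b !) ≡ (a + b) !
C-split a b = begin
  ((a + b) C a) * (a ! * b !)                        ≡⟨ cong (λ t → ((a + b) C a) * (a ! * t !)) (sym (m+n∸m≡n a b)) ⟩
  ((a + b) C a) * (a ! * (a + b ∸ a) !)              ≡⟨ cong (_* (a ! * (a + b ∸ a) !)) (nCk≡n!/k![n-k]! a≤a+b) ⟩
  ((a + b) ! / (a ! * (a + b ∸ a) !)) * (a ! * (a + b ∸ a) !) ≡⟨ m/n*n≡m (k![n∸k]!∣n! a≤a+b) ⟩
  (a + b) !                                          ∎
  where
  a≤a+b = m≤m+n a b
  instance _ = a !* (a + b ∸ a) !≢0

multinomial : ∀ a b c d → (((a + b) + (c + d)) C (a + b)) * ((a + b) C a) * ((c + d) C c) * ((a ! * b !) * (c ! * d !))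
                          ≡ ((a + b) + (c + d)) !
multinomial a b c d = begin
  x * y * z * ((a ! * b !) * (c ! * d !))      ≡⟨ regroup x y z (a ! * b !) (c ! * d !) ⟩
  x * ((y * (a ! * b !)) * (z * (c ! * d !)))  ≡⟨ cong (x *_) (cong₂ _*_ (C-split a b) (C-split c d)) ⟩
  x * ((a + b) ! * (c + d) !)                  ≡⟨ C-split (a + b) (c + d) ⟩
  ((a + b) + (c + d)) !                        ∎
  where
  x = ((a + b) + (c + d)) C (a + b)
  y = (a + b) C a
  z = (c + d) C c
  regroup : ∀ x y z p q → x * y * z * (p * q) ≡ x * ((y * p) * (z * q))
  regroup = solve-∀

occ01≤ones : ∀ w → occ01 w ≤ ones w
occ01≤ones [] = z≤n
occ01≤ones (true ∷ w) = m≤n⇒m≤1+n (occ01≤ones w)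
occ01≤ones (false ∷ []) = z≤n
occ01≤ones (false ∷ true ∷ w) = s≤s (occ01≤ones w)
occ01≤ones (false ∷ false ∷ w) = occ01≤ones (false ∷ w)

occ01-bounded-on-G : ∀ n → All (λ w → occ01 w < suc n) (G n)
occ01-bounded-on-G n = All.map (λ {w} → occ01<1+n {w}) (all-filter (T? ∘ inGᵇ n) (allWords (n + n)))
  where
  occ01<1+n : ∀ {w} → T (inGᵇ n w) → occ01 w < suc n
  occ01<1+n {w} w∈G = s≤s (subst (occ01 w ≤_) (≡ᵇ⇒≡ (ones w) n (proj₂ (Equivalence.to T-∧ w∈G))) (occ01≤ones w))

count-001-01 : ℕ → ℕ → ℕ → ℕ
count-001-01 n k ℓ = countG n (λ w → (occ001 w ≡ᵇ k) ∧ (occ01 w ≡ᵇ ℓ))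

count-001-01-closed : ∀ n k ℓ → count-001-01 n k ℓ ≡ (n C ℓ) * (ℓ C k) * C-after n ℓ k
count-001-01-closed n k ℓ = begin
  count-001-01 n k ℓ                                   ≡⟨ count-filterᵇ (inGᵇ n) _ (allWords (n + n)) ⟩
  count (λ w → inGᵇ n w ∧ _) (allWords (n + n))        ≡⟨ count-cong (λ w → ∧-assoc (zeros w ≡ᵇ n) (ones w ≡ᵇ n) _) (allWords (n + n)) ⟩
  count (hasProfile none n n k ℓ) (allWords (n + n))   ≡⟨ count-hasProfile (n + n) none n n k ℓ refl ⟩
  (n C ℓ) * (ℓ C k) * C-after n ℓ k                    ∎

count-001-01-vanishes : ∀ n k ℓ → ℓ < k ⊎ n < ℓ + k → count-001-01 n k ℓ ≡ 0
count-001-01-vanishes n k ℓ (inj₁ ℓ<k) = begin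
  count-001-01 n k ℓ                     ≡⟨ count-001-01-closed n k ℓ ⟩
  (n C ℓ) * (ℓ C k) * C-after n ℓ k      ≡⟨ cong (λ c → (n C ℓ) * c * C-after n ℓ k) (k>n⇒nCk≡0 ℓ<k) ⟩
  (n C ℓ) * 0 * C-after n ℓ k            ≡⟨ cong (_* C-after n ℓ k) (*-zeroʳ (n C ℓ)) ⟩
  0                                      ∎
count-001-01-vanishes n k ℓ (inj₂ n<ℓ+k) = begin
  count-001-01 n k ℓ                     ≡⟨ count-001-01-closed n k ℓ ⟩
  (n C ℓ) * (ℓ C k) * C-after n ℓ k      ≡⟨ cong ((n C ℓ) * (ℓ C k) *_) (C-after-vanishes n ℓ k n<ℓ+k) ⟩
  (n C ℓ) * (ℓ C k) * 0                  ≡⟨ *-zeroʳ ((n C ℓ) * (ℓ C k)) ⟩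
  0                                      ∎

count-001-01-factorial : ∀ n k j r → (k + j) + (k + r) ≡ n → count-001-01 n k (k + j) * ((k ! * k !) * (j ! * r !)) ≡ n !
count-001-01-factorial .((k + j) + (k + r)) k j r refl = begin
  count-001-01 n k (k + j) * ((k ! * k !) * (j ! * r !))
    ≡⟨ cong₂ _*_ (count-001-01-closed n k (k + j)) ([m*n]*[o*p]≡[m*o]*[n*p] (k !) (k !) (j !) (r !)) ⟩
  (n C (k + j)) * ((k + j) C k) * C-after n (k + j) k * ((k ! * j !) * (k ! * r !))
    ≡⟨ cong (λ c → (n C (k + j)) * ((k + j) C k) * c * ((k ! * j !) * (k ! * r !))) (C-after-+ (k + j) (k + r) k) ⟩
  (n C (k + j)) * ((k + j) C k) * ((k + r) C k) * ((k ! * j !) * (k ! * r !))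
    ≡⟨ multinomial k j k r ⟩
  n !                                                                              ∎
  where
  n = (k + j) + (k + r)

count-001-01-binomial : ∀ n k j r → (k + k) + (j + r) ≡ n →
                        count-001-01 n k (k + j) ≡ (n C (k + k)) * ((k + k) C k) * ((j + r) C j)
count-001-01-binomial .((k + k) + (j + r)) k j r refl = *-cancelʳ-≡ _ _ ((k ! * k !) * (j ! * r !))
  (trans (count-001-01-factorial n k j r (interchange k k j r)) (sym (multinomial k k j r)))
  where
  n = (k + k) + (j + r)
  interchange : ∀ k k′ j r → (k + j) + (k′ + r) ≡ (k + k′) + (j + r)
  interchange = solve-∀
  instance _ = m*n≢0 (k ! * k !) (j ! * r !) {{k !* k !≢0}} {{j !* r !≢0}}

count-001-01-shifted : ∀ k m j → count-001-01 ((k + k) + m) k (k + j) ≡ (((k + k) + m) C (k + k)) * ((k + k) C k) * (m C j)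
count-001-01-shifted k m j with j ≤? m
... | yes j≤m with m≤n⇒∃[o]m+o≡n j≤m
...   | r , refl = count-001-01-binomial _ k j r refl
count-001-01-shifted k m j | no j≰m = begin
  count-001-01 n k (k + j)              ≡⟨ count-001-01-vanishes n k (k + j) (inj₂ n<k+j+k) ⟩
  0                                     ≡⟨ *-zeroʳ ((n C (k + k)) * ((k + k) C k)) ⟨
  (n C (k + k)) * ((k + k) C k) * 0     ≡⟨ cong ((n C (k + k)) * ((k + k) C k) *_) (k>n⇒nCk≡0 (≰⇒> j≰m)) ⟨
  (n C (k + k)) * ((k + k) C k) * (m C j) ∎
  where
  n = (k + k) + m
  reorder : ∀ k j → (k + k) + j ≡ (k + j) + k
  reorder = solve-∀
  n<k+j+k : n < (k + j) + k
  n<k+j+k = <-≤-trans (+-monoʳ-< (k + k) (≰⇒> j≰m)) (≤-reflexive (reorder k j))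

∑-count-001-01 : ∀ n k → ∑[ ℓ < suc n ] count-001-01 n k ℓ ≡ (n C (k + k)) * ((k + k) C k) * 2 ^ (n ∸ (k + k))
∑-count-001-01 n k with k + k ≤? n
... | no 2k≰n = begin
  ∑[ ℓ < suc n ] count-001-01 n k ℓ                ≡⟨ ∑-zero (suc n) _ (λ ℓ _ → count-001-01-vanishes n k ℓ (ℓ<k⊎n<ℓ+k ℓ)) ⟩
  0                                                ≡⟨ cong (λ c → c * ((k + k) C k) * 2 ^ (n ∸ (k + k))) (k>n⇒nCk≡0 n<2k) ⟨
  (n C (k + k)) * ((k + k) C k) * 2 ^ (n ∸ (k + k)) ∎
  where
  n<2k = ≰⇒> 2k≰n
  ℓ<k⊎n<ℓ+k : ∀ ℓ → ℓ < k ⊎ n < ℓ + k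
  ℓ<k⊎n<ℓ+k ℓ with ℓ <? k
  ... | yes ℓ<k = inj₁ ℓ<k
  ... | no ℓ≮k = inj₂ (<-≤-trans n<2k (+-monoˡ-≤ k (≮⇒≥ ℓ≮k)))
... | yes 2k≤n with m≤n⇒∃[o]m+o≡n 2k≤n
...   | m , refl = begin
  ∑[ ℓ < suc n ] f ℓ                              ≡⟨ cong (λ b → ∑< b f) (reorder k m) ⟩
  ∑< (k + suc (k + m)) f                          ≡⟨ ∑-split k (suc (k + m)) f ⟩
  ∑< k f + ∑[ j < suc (k + m) ] f (k + j)          ≡⟨ cong₂ _+_ (∑-zero k f (λ ℓ ℓ<k → count-001-01-vanishes n k ℓ (inj₁ ℓ<k)))
                                                                (∑-cong (suc (k + m)) (λ j _ → count-001-01-shifted k m j)) ⟩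
  ∑[ j < suc (k + m) ] (c * (m C j))               ≡⟨ *-distribˡ-∑ (suc (k + m)) c (m C_) ⟩
  c * ∑[ j < suc (k + m) ] (m C j)                 ≡⟨ cong (c *_) (∑-C m (suc (k + m)) (s≤s (m≤n+m m k))) ⟩
  c * 2 ^ m                                       ≡⟨ cong (λ e → c * 2 ^ e) (m+n∸m≡n (k + k) m) ⟨
  c * 2 ^ (n ∸ (k + k))                           ∎
  where
  f = count-001-01 n k
  c = (n C (k + k)) * ((k + k) C k)
  reorder : ∀ k m → suc ((k + k) + m) ≡ k + suc (k + m)
  reorder = solve-∀

2*k≡k+k : ∀ k → 2 * k ≡ k + k
2*k≡k+k = solve-∀

count-001 : ∀ n k → countG n (λ w → occ001 w ≡ᵇ k) ≡ (n C (2 * k)) * ((2 * k) C k) * 2 ^ (n ∸ 2 * k)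
count-001 n k = begin
  countG n (λ w → occ001 w ≡ᵇ k)                      ≡⟨ count-partition _ occ01 (G n) (occ01-bounded-on-G n) ⟩
  ∑[ ℓ < suc n ] count-001-01 n k ℓ                   ≡⟨ ∑-count-001-01 n k ⟩
  (n C (k + k)) * ((k + k) C k) * 2 ^ (n ∸ (k + k))   ≡⟨ cong (λ t → (n C t) * (t C k) * 2 ^ (n ∸ t)) (2*k≡k+k k) ⟨
  (n C (2 * k)) * ((2 * k) C k) * 2 ^ (n ∸ 2 * k)     ∎

count-001-01-in-range : ∀ n k ℓ → k ≤ ℓ → k + ℓ ≤ n →
    (count-001-01 n k ℓ ≡ (n C (2 * k)) * ((2 * k) C k) * ((n ∸ 2 * k) C (ℓ ∸ k)))
    × (count-001-01 n k ℓ * ((k ! * k !) * ((ℓ ∸ k) ! * (n ∸ k ∸ ℓ) !)) ≡ n !)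
count-001-01-in-range n k ℓ k≤ℓ k+ℓ≤n with m≤n⇒∃[o]m+o≡n k≤ℓ
... | j , refl with m≤n⇒∃[o]m+o≡n k+ℓ≤n
...   | r , refl = binomial-form , factorial-form
  where
  n′ = k + (k + j) + r
  split₁ : ∀ k j r → (k + k) + (j + r) ≡ k + (k + j) + r
  split₁ = solve-∀
  split₂ : ∀ k j r → (k + j) + (k + r) ≡ k + (k + j) + r
  split₂ = solve-∀
  n′∸[k+k]≡j+r : n′ ∸ (k + k) ≡ j + r
  n′∸[k+k]≡j+r = trans (cong (_∸ (k + k)) (sym (split₁ k j r))) (m+n∸m≡n (k + k) (j + r))
  n′∸k∸[k+j]≡r : n′ ∸ k ∸ (k + j) ≡ r
  n′∸k∸[k+j]≡r = trans (∸-+-assoc n′ k (k + j)) (m+n∸m≡n (k + (k + j)) r)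
  binomial-form = begin
    count-001-01 n′ k (k + j)                          ≡⟨ count-001-01-binomial n′ k j r (split₁ k j r) ⟩
    (n′ C (k + k)) * ((k + k) C k) * ((j + r) C j)     ≡⟨ cong (λ e → (n′ C (k + k)) * ((k + k) C k) * (e C j)) n′∸[k+k]≡j+r ⟨
    (n′ C (k + k)) * ((k + k) C k) * ((n′ ∸ (k + k)) C j)
      ≡⟨ cong₂ (λ t d → (n′ C t) * (t C k) * ((n′ ∸ t) C d)) (2*k≡k+k k) (m+n∸m≡n k j) ⟨
    (n′ C (2 * k)) * ((2 * k) C k) * ((n′ ∸ 2 * k) C ((k + j) ∸ k)) ∎
  factorial-form = begin
    count-001-01 n′ k (k + j) * ((k ! * k !) * (((k + j) ∸ k) ! * (n′ ∸ k ∸ (k + j)) !))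
      ≡⟨ cong₂ (λ a b → count-001-01 n′ k (k + j) * ((k ! * k !) * (a ! * b !))) (m+n∸m≡n k j) n′∸k∸[k+j]≡r ⟩
    count-001-01 n′ k (k + j) * ((k ! * k !) * (j ! * r !)) ≡⟨ count-001-01-factorial n′ k j r (split₂ k j r) ⟩
    n′ !                                                    ∎

corollary3p6 : ((n k : ℕ) → countG n (λ w → occ001 w ≡ᵇ k) ≡ (n C (2 * k)) * ((2 * k) C k) * 2 ^ (n ∸ 2 * k))
    × ((n k ℓ : ℕ) → k ≤ ℓ → k + ℓ ≤ n →
        (countG n (λ w → (occ001 w ≡ᵇ k) ∧ (occ01 w ≡ᵇ ℓ)) ≡ (n C (2 * k)) * ((2 * k) C k) * ((n ∸ 2 * k) C (ℓ ∸ k)))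
        × (countG n (λ w → (occ001 w ≡ᵇ k) ∧ (occ01 w ≡ᵇ ℓ)) * ((k ! * k !) * ((ℓ ∸ k) ! * (n ∸ k ∸ ℓ) !)) ≡ n !))
corollary3p6 = count-001 , count-001-01-in-range
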